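{- Let $v$ be odd. Consider a decomposition of the edge set of $K_v$ into $\alpha$ copies of $K_3$, $\beta$ copies of $K_4$ and $\gamma$ copies of $K_5$. If $\beta>0$, then $\beta\ge 5$.
   Context: A decomposition of the edge set of $K_v$ into cliques means a collection of complete subgraphs of $K_v$ such that every edge of $K_v$ lies in exactly one of them. -}

module Defs where

open import Data.Nat using (ℕ; suc)
import Data.Nat
open import Data.Fin using (Fin)
open import Data.Fin.Properties using (_≟_)
open import Data.List using (List; length; filter; map; _++_)
open import Data.List.Relation.Unary.Unique.Propositional using (Unique)
open import Data.List.Relation.Unary.All using (All)
open import Data.List.Membership.Propositional using (_∈_)
open import Data.List.Relation.Unary.Any using (any?)
open import Data.Product using (_×_; _,_)
open import Relation.Binary.PropositionalEquality using (_≡_)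
open import Relation.Nullary using (¬_; Dec)
open import Relation.Nullary.Decidable using (_×-dec_)

record Clique (v : ℕ) : Set where
  constructor clique
  field
    verts    : List (Fin v)
    distinct : Unique verts
open Clique public

_∈v?_ : ∀ {v} (x : Fin v) (xs : List (Fin v)) → Dec (x ∈ xs)
x ∈v? xs = any? (x ≟_) xs

containsEdge? : ∀ {v} (x y : Fin v) (C : Clique v) → Dec ((x ∈ verts C) × (y ∈ verts C))
containsEdge? x y C = (x ∈v? verts C) ×-dec (y ∈v? verts C)

edgeMult : ∀ {v} → List (Clique v) → Fin v → Fin v → ℕ
edgeMult cs x y = length (filter (containsEdge? x y) cs)

IsCliqueDecomposition : ∀ {v} → List (Clique v) → Set
IsCliqueDecomposition {v} cs = ∀ (x y : Fin v) → ¬ (x ≡ y) → edgeMult cs x y ≡ 1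

numOfOrder : ∀ {v} → ℕ → List (Clique v) → ℕ
numOfOrder k cs = length (filter (λ C → length (verts C) Data.Nat.≟ k) cs)

data Order345 : ℕ → Set where
  o3 : Order345 3
  o4 : Order345 4
  o5 : Order345 5

-- Fix a vertex a. The cliques through a partition the other v − 1 vertices, so the numbers
-- |C| − 1 of the cliques C ∋ a add up to v − 1, which is even. Triangles and K₅'s contribute
-- even amounts and each K₄ contributes 3, so every vertex lies in an even number of K₄'s.
-- Hence each of the four vertices of a K₄ lies in a further K₄, and these further K₄'s are
-- pairwise distinct since two vertices of the first K₄ already have their edge covered.
module Submission where

open import Defs
open import Level using (Level)
open import Data.Bool using (if_then_else_)
open import Function using (_∘_)
open import Data.Fin using (Fin; zero; suc)
open import Data.Fin.Properties using (_≟_; suc-injective)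
open import Data.List using (List; []; _∷_; length; filter; lookup)
open import Data.List.Membership.Propositional using (_∈_)
open import Data.List.Membership.Propositional.Properties using (∈-lookup)
open import Data.List.Relation.Unary.All as All using (All)
open import Data.List.Relation.Unary.All.Properties using (All¬⇒¬Any)
open import Data.List.Relation.Unary.AllPairs using (_∷_)
open import Data.List.Relation.Unary.Any using (here; there)
open import Data.List.Relation.Unary.Unique.Propositional using (Unique)
open import Data.Nat as ℕ using (ℕ; zero; suc; _+_; _*_; _<_; _≤_; z≤n; s≤s)
open import Data.Nat.DivMod using (_%_; _/_; m≡m%n+[m/n]*n)
open import Data.Nat.Divisibility using (_∣_; divides; ∣m∣n⇒∣m+n; ∣m+n∣m⇒∣n; n∣m*n; ∣1⇒≡1)
open import Data.Nat.Properties
  using (+-*-semiring; +-assoc; +-identityʳ; +-comm; +-suc; +-mono-≤; *-monoˡ-≤; +-cancelʳ-≡; m+n≡0⇒m≡0; m+n≡0⇒n≡0; ≤-reflexive; module ≤-Reasoning)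
open import Data.Nat.Tactic.RingSolver using (solve-∀)
open import Data.Product using (∃; _,_)
open import Data.Vec.Functional using (Vector; removeAt)
open import Relation.Binary.PropositionalEquality
open import Relation.Nullary using (Dec; yes; no; does; ¬_; contradiction)
open import Relation.Nullary.Decidable using (_×-dec_; _⊎-dec_; dec-true)
open import Relation.Unary using (Pred; Decidable)

open import Algebra.Properties.Semiring.Sum +-*-semiring
  using (sum; sum-syntax; sum-cong-≗; sum-replicate-zero; ∑-distrib-+; ∑-comm; *-distribˡ-sum; *-distribʳ-sum; sum-remove)

private
  variable
    a p : Level
    A : Set a
    P : Set p
    n v : ℕ

⟦_⟧ : Dec P → ℕ
⟦ d ⟧ = if does d then 1 else 0

⟦⟧≡1 : (d : Dec P) → P → ⟦ d ⟧ ≡ 1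
⟦⟧≡1 d x rewrite dec-true d x = refl

⟦⟧>0⇒ : (d : Dec P) → 0 < ⟦ d ⟧ → P
⟦⟧>0⇒ (yes x) _ = x

⟦⟧-idem : (d : Dec P) → ⟦ d ⟧ * ⟦ d ⟧ ≡ ⟦ d ⟧
⟦⟧-idem (yes _) = refl
⟦⟧-idem (no _)  = refl

⟦×-dec⟧ : ∀ {q} {Q : Set q} (d : Dec P) (e : Dec Q) → ⟦ d ×-dec e ⟧ ≡ ⟦ d ⟧ * ⟦ e ⟧
⟦×-dec⟧ (yes _) (yes _) = refl
⟦×-dec⟧ (yes _) (no _)  = refl
⟦×-dec⟧ (no _)  _       = refl

⟦⊎-dec⟧ : ∀ {q} {Q : Set q} (d : Dec P) (e : Dec Q) → (P → ¬ Q) → ⟦ d ⊎-dec e ⟧ ≡ ⟦ d ⟧ + ⟦ e ⟧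
⟦⊎-dec⟧ (yes x) (yes y) disjoint = contradiction y (disjoint x)
⟦⊎-dec⟧ (yes _) (no _)  _        = refl
⟦⊎-dec⟧ (no _)  _       _        = refl

∑-mono-≤ : {f g : Vector ℕ n} → (∀ i → f i ≤ g i) → sum f ≤ sum g
∑-mono-≤ {zero}  f≤g = z≤n
∑-mono-≤ {suc n} f≤g = +-mono-≤ (f≤g zero) (∑-mono-≤ (λ i → f≤g (suc i)))

∑-1 : ∀ n → ∑[ i < n ] 1 ≡ n
∑-1 zero    = refl
∑-1 (suc n) = cong suc (∑-1 n)

n≤∑ : {f : Vector ℕ n} → (∀ i → 1 ≤ f i) → n ≤ sum f
n≤∑ {n} {f} 1≤f = subst (_≤ sum f) (∑-1 n) (∑-mono-≤ 1≤f)

∑≡0⇒≡0 : {f : Vector ℕ n} → sum f ≡ 0 → ∀ i → f i ≡ 0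
∑≡0⇒≡0 {f = f} ∑f≡0 zero    = m+n≡0⇒m≡0 (f zero) ∑f≡0
∑≡0⇒≡0 {f = f} ∑f≡0 (suc i) = ∑≡0⇒≡0 (m+n≡0⇒n≡0 (f zero) ∑f≡0) i

∑>0⇒∃ : {f : Vector ℕ n} → 0 < sum f → ∃ λ i → 0 < f i
∑>0⇒∃ {suc n} {f} ∑f>0 with f zero in eq
... | suc _ = zero , subst (0 <_) (sym eq) (s≤s z≤n)
... | zero  with ∑>0⇒∃ {f = λ i → f (suc i)} ∑f>0
...   | i , fi>0 = suc i , fi>0

2∣1+n⇒1≤n : 2 ∣ suc n → 1 ≤ n
2∣1+n⇒1≤n {zero}  2∣1 = contradiction (∣1⇒≡1 2∣1) λ ()
2∣1+n⇒1≤n {suc n} _   = s≤s z≤n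

∣-∑ : ∀ {d} {f : Vector ℕ n} → (∀ i → d ∣ f i) → d ∣ sum f
∣-∑ {zero}  d∣f = divides 0 refl
∣-∑ {suc n} d∣f = ∣m∣n⇒∣m+n (d∣f zero) (∣-∑ (λ i → d∣f (suc i)))

∑-1-except : {f : Vector ℕ n} (a : Fin n) → (∀ y → y ≢ a → f y ≡ 1) → sum f + 1 ≡ f a + n
∑-1-except {suc n} {f} zero f≡1 =
  begin
    f zero + ∑[ y < n ] f (suc y) + 1  ≡⟨ cong (λ s → f zero + s + 1) (trans (sum-cong-≗ (λ y → f≡1 (suc y) λ ())) (∑-1 n)) ⟩
    f zero + n + 1                     ≡⟨ +-assoc (f zero) n 1 ⟩
    f zero + (n + 1)                   ≡⟨ cong (f zero +_) (+-comm n 1) ⟩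
    f zero + suc n                     ∎
  where open ≡-Reasoning
∑-1-except {suc n} {f} (suc a) f≡1 =
  begin
    f zero + ∑[ y < n ] f (suc y) + 1  ≡⟨ cong (λ s → s + ∑[ y < n ] f (suc y) + 1) (f≡1 zero λ ()) ⟩
    suc (∑[ y < n ] f (suc y) + 1)     ≡⟨ cong suc (∑-1-except a (λ y y≢a → f≡1 (suc y) (y≢a ∘ suc-injective))) ⟩
    suc (f (suc a) + n)                ≡⟨ +-suc (f (suc a)) n ⟨
    f (suc a) + suc n                  ∎
  where
  open ≡-Reasoning

length-filter≡∑ : {P : Pred A p} (P? : Decidable P) (xs : List A) →
                  length (filter P? xs) ≡ ∑[ i < length xs ] ⟦ P? (lookup xs i) ⟧
length-filter≡∑ P? []       = refl
length-filter≡∑ P? (x ∷ xs) with P? x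
... | yes _ = cong suc (length-filter≡∑ P? xs)
... | no _  = length-filter≡∑ P? xs

∑-δ : (x : Fin n) → ∑[ y < n ] ⟦ y ≟ x ⟧ ≡ 1
∑-δ {suc n} zero    = cong suc (sum-replicate-zero n)
∑-δ {suc n} (suc x) = ∑-δ x

∑-⟦∈⟧ : (xs : List (Fin v)) → Unique xs → ∑[ y < v ] ⟦ y ∈v? xs ⟧ ≡ length xs
∑-⟦∈⟧ {v} []       _            = sum-replicate-zero v
∑-⟦∈⟧ {v} (x ∷ xs) (x∉xs ∷ !xs) = begin
  ∑[ y < v ] ⟦ y ∈v? (x ∷ xs) ⟧                      ≡⟨ sum-cong-≗ (λ y → ⟦⊎-dec⟧ (y ≟ x) (y ∈v? xs) λ { refl → All¬⇒¬Any x∉xs }) ⟩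
  ∑[ y < v ] (⟦ y ≟ x ⟧ + ⟦ y ∈v? xs ⟧)              ≡⟨ ∑-distrib-+ (λ y → ⟦ y ≟ x ⟧) (λ y → ⟦ y ∈v? xs ⟧) ⟩
  ∑[ y < v ] ⟦ y ≟ x ⟧ + ∑[ y < v ] ⟦ y ∈v? xs ⟧     ≡⟨ cong₂ _+_ (∑-δ x) (∑-⟦∈⟧ xs !xs) ⟩
  suc (length xs)                                     ∎
  where open ≡-Reasoning

order : Clique v → ℕ
order C = length (verts C)

incidence : Fin v → Clique v → ℕ
incidence x C = ⟦ x ∈v? verts C ⟧

isK₄ : Clique v → ℕ
isK₄ C = ⟦ order C ℕ.≟ 4 ⟧

-- m (k − 1) ≡ m [k = 4] (mod 2), written without subtraction
order345-parity : ∀ {k} → Order345 k → ∀ m → 2 ∣ m * k + (m + m * ⟦ k ℕ.≟ 4 ⟧)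
order345-parity o3 m = divides (2 * m) (solve m)
  where solve : ∀ m → m * 3 + (m + m * 0) ≡ 2 * m * 2
        solve = solve-∀
order345-parity o4 m = divides (3 * m) (solve m)
  where solve : ∀ m → m * 4 + (m + m * 1) ≡ 3 * m * 2
        solve = solve-∀
order345-parity o5 m = divides (3 * m) (solve m)
  where solve : ∀ m → m * 5 + (m + m * 0) ≡ 3 * m * 2
        solve = solve-∀

module _ {v n : ℕ} (t : Vector (Clique v) n) where

  edgeMultᵛ : Fin v → Fin v → ℕ
  edgeMultᵛ x y = ∑[ i < n ] (incidence x (t i) * incidence y (t i))

  IsCliqueDecompositionᵛ : Set
  IsCliqueDecompositionᵛ = ∀ x y → x ≢ y → edgeMultᵛ x y ≡ 1

  through : Fin v → ℕ
  through a = ∑[ i < n ] incidence a (t i)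

  orders-through : Fin v → ℕ
  orders-through a = ∑[ i < n ] (incidence a (t i) * order (t i))

  k₄s-through : Fin v → ℕ
  k₄s-through a = ∑[ i < n ] (incidence a (t i) * isK₄ (t i))

  k₄-count : ℕ
  k₄-count = ∑[ i < n ] isK₄ (t i)

  orders-through≡∑edgeMultᵛ : ∀ a → orders-through a ≡ ∑[ y < v ] edgeMultᵛ a y
  orders-through≡∑edgeMultᵛ a = begin
    ∑[ i < n ] (incidence a (t i) * order (t i))                     ≡⟨ sum-cong-≗ (λ i → cong (incidence a (t i) *_) (∑-⟦∈⟧ _ (distinct (t i)))) ⟨
    ∑[ i < n ] (incidence a (t i) * ∑[ y < v ] incidence y (t i))    ≡⟨ sum-cong-≗ (λ i → *-distribˡ-sum (incidence a (t i)) (λ y → incidence y (t i))) ⟩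
    ∑[ i < n ] ∑[ y < v ] (incidence a (t i) * incidence y (t i))    ≡⟨ ∑-comm (λ i y → incidence a (t i) * incidence y (t i)) ⟩
    ∑[ y < v ] edgeMultᵛ a y                                       ∎
    where open ≡-Reasoning

  -- Σ_{C ∋ a} (|C| − 1) = v − 1, with both sides moved so that no subtraction occurs.
  orders-through+1≡through+v : IsCliqueDecompositionᵛ → ∀ a → orders-through a + 1 ≡ through a + v
  orders-through+1≡through+v decomposition a = begin
    orders-through a + 1            ≡⟨ cong (_+ 1) (orders-through≡∑edgeMultᵛ a) ⟩
    ∑[ y < v ] edgeMultᵛ a y + 1    ≡⟨ ∑-1-except a (λ y y≢a → decomposition a y (y≢a ∘ sym)) ⟩
    edgeMultᵛ a a + v               ≡⟨ cong (_+ v) (sum-cong-≗ (λ i → ⟦⟧-idem (a ∈v? verts (t i)))) ⟩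
    through a + v                   ∎
    where open ≡-Reasoning

  2∣orders-through+through+k₄s-through : (∀ i → Order345 (order (t i))) → ∀ a →
                                         2 ∣ orders-through a + (through a + k₄s-through a)
  2∣orders-through+through+k₄s-through orders a =
    subst (2 ∣_) ∑-split (∣-∑ (λ i → order345-parity (orders i) (incidence a (t i))))
    where
    ∑-split : ∑[ i < n ] (incidence a (t i) * order (t i) + (incidence a (t i) + incidence a (t i) * isK₄ (t i)))
              ≡ orders-through a + (through a + k₄s-through a)
    ∑-split = trans (∑-distrib-+ _ (λ i → incidence a (t i) + incidence a (t i) * isK₄ (t i)))
                    (cong (orders-through a +_) (∑-distrib-+ (λ i → incidence a (t i)) _))

  2∣k₄s-through : v % 2 ≡ 1 → (∀ i → Order345 (order (t i))) → IsCliqueDecompositionᵛ → ∀ a → 2 ∣ k₄s-through a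
  2∣k₄s-through v-odd orders decomposition a =
    ∣m+n∣m⇒∣n (subst (2 ∣_) (cancel (orders-through a) (through a) (k₄s-through a) degree)
                           (2∣orders-through+through+k₄s-through orders a))
              (n∣m*n (through a + v / 2))
    where
    degree : orders-through a + 1 ≡ through a + (1 + v / 2 * 2)
    degree = trans (orders-through+1≡through+v decomposition a)
                   (cong (through a +_) (trans (m≡m%n+[m/n]*n v 2) (cong (_+ v / 2 * 2) v-odd)))
    shuffle : ∀ E q → E + (1 + q * 2) ≡ E + q * 2 + 1
    shuffle = solve-∀
    regroup : ∀ E K q → E + q * 2 + (E + K) ≡ (E + q) * 2 + K
    regroup = solve-∀
    cancel : ∀ D E K {q} → D + 1 ≡ E + (1 + q * 2) → D + (E + K) ≡ (E + q) * 2 + K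
    cancel D E K {q} eq rewrite +-cancelʳ-≡ 1 D (E + q * 2) (trans eq (shuffle E q)) = regroup E K q

∑-incidence≤1 : (xs : List (Fin v)) → Unique xs → (C : Clique v) →
                (∀ {x y} → x ∈ xs → y ∈ xs → x ≢ y → incidence x C * incidence y C ≡ 0) →
                ∑[ k < length xs ] incidence (lookup xs k) C ≤ 1
∑-incidence≤1 []       _            C _        = z≤n
∑-incidence≤1 (x ∷ xs) (x∉xs ∷ !xs) C disjoint with x ∈v? verts C
... | yes x∈C = ≤-reflexive (cong suc (trans (sum-cong-≗ others∉C) (sum-replicate-zero (length xs))))
  where
  others∉C : ∀ k → incidence (lookup xs k) C ≡ 0
  others∉C k = trans (sym (+-identityʳ _))
    (trans (cong (_* incidence (lookup xs k) C) (sym (⟦⟧≡1 (x ∈v? verts C) x∈C)))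
      (disjoint (here refl) (there (∈-lookup k)) (All.lookup x∉xs (∈-lookup k))))
... | no _ = ∑-incidence≤1 xs !xs C (λ x∈ y∈ → disjoint (there x∈) (there y∈))

module _ {v n : ℕ} (t : Vector (Clique v) (suc n)) (decomposition : IsCliqueDecompositionᵛ t)
         (i : Fin (suc n)) where

  private
    others : Vector (Clique v) n
    others = removeAt t i

  others-share-no-edge : ∀ {x y} → x ∈ verts (t i) → y ∈ verts (t i) → x ≢ y →
                         ∀ j → incidence x (others j) * incidence y (others j) ≡ 0
  others-share-no-edge {x} {y} x∈ y∈ x≢y = ∑≡0⇒≡0 (cong ℕ.pred (begin
    suc (edgeMultᵛ others x y)                                    ≡⟨ cong₂ (λ p q → p * q + edgeMultᵛ others x y) (⟦⟧≡1 (x ∈v? verts (t i)) x∈) (⟦⟧≡1 (y ∈v? verts (t i)) y∈) ⟨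
    incidence x (t i) * incidence y (t i) + edgeMultᵛ others x y  ≡⟨ sum-remove (λ j → incidence x (t j) * incidence y (t j)) ⟨
    edgeMultᵛ t x y                                               ≡⟨ decomposition x y x≢y ⟩
    1                                                             ∎))
    where open ≡-Reasoning

  order≤∑-others : (w : Clique v → ℕ) →
                   (∀ {x} → x ∈ verts (t i) → 1 ≤ ∑[ j < n ] (incidence x (others j) * w (others j))) →
                   order (t i) ≤ ∑[ j < n ] w (others j)
  order≤∑-others w covered = begin
    order (t i)                                                          ≤⟨ n≤∑ (λ k → covered (∈-lookup k)) ⟩
    ∑[ k < order (t i) ] ∑[ j < n ] (incidence (xs k) (others j) * w (others j))  ≡⟨ ∑-comm (λ k j → incidence (xs k) (others j) * w (others j)) ⟩
    ∑[ j < n ] ∑[ k < order (t i) ] (incidence (xs k) (others j) * w (others j))  ≡⟨ sum-cong-≗ (λ j → *-distribʳ-sum (w (others j)) (λ k → incidence (xs k) (others j))) ⟨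
    ∑[ j < n ] (∑[ k < order (t i) ] incidence (xs k) (others j) * w (others j))  ≤⟨ ∑-mono-≤ (λ j → *-monoˡ-≤ (w (others j)) (meets-once j)) ⟩
    ∑[ j < n ] (1 * w (others j))                                        ≡⟨ sum-cong-≗ (λ j → +-identityʳ (w (others j))) ⟩
    ∑[ j < n ] w (others j)                                              ∎
    where
    open ≤-Reasoning
    xs : Fin (order (t i)) → Fin v
    xs = lookup (verts (t i))
    meets-once : ∀ j → ∑[ k < order (t i) ] incidence (xs k) (others j) ≤ 1
    meets-once j = ∑-incidence≤1 (verts (t i)) (distinct (t i)) (others j)
                     (λ x∈ y∈ x≢y → others-share-no-edge x∈ y∈ x≢y j)

  1≤k₄s-through-others : v % 2 ≡ 1 → (∀ j → Order345 (order (t j))) → isK₄ (t i) ≡ 1 →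
                         ∀ {x} → x ∈ verts (t i) → 1 ≤ k₄s-through others x
  1≤k₄s-through-others v-odd orders t[i]-is-K₄ {x} x∈ =
    2∣1+n⇒1≤n (subst (2 ∣_) remove-t[i] (2∣k₄s-through t v-odd orders decomposition x))
    where
    remove-t[i] : k₄s-through t x ≡ suc (k₄s-through others x)
    remove-t[i] = trans (sum-remove (λ j → incidence x (t j) * isK₄ (t j)))
                        (cong₂ (λ p q → p * q + k₄s-through others x) (⟦⟧≡1 (x ∈v? verts (t i)) x∈) t[i]-is-K₄)

edgeMult≡edgeMultᵛ : (cs : List (Clique v)) (x y : Fin v) → edgeMult cs x y ≡ edgeMultᵛ (lookup cs) x y
edgeMult≡edgeMultᵛ cs x y =
  trans (length-filter≡∑ (containsEdge? x y) cs)
        (sum-cong-≗ (λ i → ⟦×-dec⟧ (x ∈v? verts (lookup cs i)) (y ∈v? verts (lookup cs i))))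

numOfOrder4≡k₄-count : (cs : List (Clique v)) → numOfOrder 4 cs ≡ k₄-count (lookup cs)
numOfOrder4≡k₄-count = length-filter≡∑ (λ C → order C ℕ.≟ 4)

5≤k₄-count : v % 2 ≡ 1 → (t : Vector (Clique v) n) → (∀ i → Order345 (order (t i))) →
             IsCliqueDecompositionᵛ t → 0 < k₄-count t → 5 ≤ k₄-count t
5≤k₄-count {n = zero}  _     _ _      _             ()
5≤k₄-count {n = suc n} v-odd t orders decomposition k₄-count>0 with ∑>0⇒∃ k₄-count>0
... | i , t[i]-is-K₄ = begin
  5                                    ≡⟨ cong suc order≡4 ⟨
  1 + order (t i)                      ≤⟨ s≤s (order≤∑-others t decomposition i isK₄
                                                (1≤k₄s-through-others t decomposition i v-odd orders isK₄≡1)) ⟩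
  1 + k₄-count (removeAt t i)          ≡⟨ cong (_+ k₄-count (removeAt t i)) isK₄≡1 ⟨
  isK₄ (t i) + k₄-count (removeAt t i) ≡⟨ sum-remove (λ j → isK₄ (t j)) ⟨
  k₄-count t                           ∎
  where
  open ≤-Reasoning
  order≡4 : order (t i) ≡ 4
  order≡4 = ⟦⟧>0⇒ (order (t i) ℕ.≟ 4) t[i]-is-K₄
  isK₄≡1 : isK₄ (t i) ≡ 1
  isK₄≡1 = ⟦⟧≡1 (order (t i) ℕ.≟ 4) order≡4

lemma36 : (v : ℕ) → v % 2 ≡ 1 → (cs : List (Clique v)) →
    All (λ C → Order345 (length (verts C))) cs →
    IsCliqueDecomposition cs →
    0 < numOfOrder 4 cs → 5 ≤ numOfOrder 4 cs
lemma36 v v-odd cs orders decomposition k₄-count>0 =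
  subst (5 ≤_) (sym (numOfOrder4≡k₄-count cs))
    (5≤k₄-count v-odd (lookup cs) (λ i → All.lookup orders (∈-lookup i))
      (λ x y x≢y → trans (sym (edgeMult≡edgeMultᵛ cs x y)) (decomposition x y x≢y))
      (subst (0 <_) (numOfOrder4≡k₄-count cs) k₄-count>0))
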